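{- Let $f$ be a Boolean network and $\beta$ a phenotype of $f$. Then the fixed points of $f$ that satisfy $\beta$ are in one-to-one correspondence with the answer sets of $\mathrm{fASP}(f)\cup\mathrm{toASP}(\beta)$, the correspondence sending an answer set $M$ to the state $s$ with $s_v=1$ iff $p_v\in M$ (and then $n_v\notin M$) and $s_v=0$ iff $n_v\in M$ (and then $p_v\notin M$).
   Context: A Boolean network (BN) $f$ consists of a finite set of variables $\mathrm{var}(f)$ and, for each $v\in\mathrm{var}(f)$, a Boolean function $f_v$ given as a propositional formula over $\mathrm{var}(f)$. A state is a map $s:\mathrm{var}(f)\to\{0,1\}$; a fixed point is a state $s$ with $f_v(s)=s_v$ for all $v$. A sub-space is a map $m:\mathrm{var}(f)\to\{0,1,\star\}$; a fixed point is identified with the sub-space taking no value $\star$. A phenotype $\beta$ is a conjunction of traits $(v\leftrightarrow e)$ with $v\in\mathrm{var}(f)$, $e\in\{0,1,\star\}$ (for fixed points only $e\in\{0,1\}$ is meaningful); a sub-space $m$ satisfies $\beta$ if $m(v)=e$ for every trait. Answer set programs: rules $a_1\vee\dots\vee a_k\leftarrow b_1,\dots,b_m,\mathit{not}\,c_1,\dots,\mathit{not}\,c_n$; $M$ satisfies $r$ if $(H(r)\cup B^-(r))\cap M\neq\emptyset$ or $B^+(r)\setminus M\ne\emptyset$; the reduct $P^M=\{H(r)\leftarrow B^+(r): r\in P, M\cap B^-(r)=\emptyset\}$; $M$ is an answer set of $P$ if $M$ is a model of $P$ and no proper subset of $M$ is a model of $P^M$. Constraints are rules with empty head, written $\bot\leftarrow\dots$.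 The program $\mathrm{fASP}(f)$: for each $v\in\mathrm{var}(f)$ introduce atoms $p_v,n_v$, the rule $p_v\vee n_v\leftarrow\top$, the constraint $\bot\leftarrow p_v,n_v$, and the rules $\gamma(v)\leftarrow\gamma(\Phi_v^+)$ and $\gamma(\neg v)\leftarrow\gamma(\Phi_v^-)$ where $\Phi_v^+$, $\Phi_v^-$ are negation normal forms of $f_v$ and $\neg f_v$. Here $\gamma(v)=p_v$, $\gamma(\neg v)=n_v$, $\gamma(\alpha_1\wedge\dots\wedge\alpha_J)=\gamma(\alpha_1),\dots,\gamma(\alpha_J)$ (a rule body), and $\gamma(\alpha_1\vee\dots\vee\alpha_J)=\mathit{aux}_k$ for a fresh auxiliary atom with added rules $\mathit{aux}_k\leftarrow\gamma(\alpha_j)$ for each $j$. The program $\mathrm{toASP}(\beta)$: for each trait $(v\leftrightarrow e)$ add $\bot\leftarrow\mathit{not}\,p_v$ and $\bot\leftarrow n_v$ if $e=1$; $\bot\leftarrow p_v$ and $\bot\leftarrow\mathit{not}\,n_v$ if $e=0$; $\bot\leftarrow\mathit{not}\,p_v$ and $\bot\leftarrow\mathit{not}\,n_v$ if $e=\star$. -}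

module Defs where

open import Data.Nat using (ℕ; zero; suc)
open import Data.Bool using (Bool; true; false; not; _∧_; _∨_)
open import Data.Fin using (Fin)
open import Data.Vec using (Vec; lookup; tabulate)
open import Data.List using (List; []; _∷_; _++_; filterᵇ; map; allFin; concatMap)
open import Data.List.Relation.Unary.All using (All)
open import Data.List.Relation.Unary.Any using (Any)
open import Data.Product using (_×_; _,_; Σ)
open import Data.Sum using (_⊎_)
open import Relation.Binary.PropositionalEquality using (_≡_)

data Form (n : ℕ) : Set where
  const : Bool → Form n
  var   : Fin n → Form n
  ¬ᶠ_   : Form n → Form n
  _∧ᶠ_  : Form n → Form n → Form n
  _∨ᶠ_  : Form n → Form n → Form n

State : ℕ → Set
State n = Vec Bool n

eval : ∀ {n} → Form n → State n → Bool
eval (const b) s = b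
eval (var v)   s = lookup s v
eval (¬ᶠ φ)    s = not (eval φ s)
eval (φ ∧ᶠ ψ)  s = eval φ s ∧ eval ψ s
eval (φ ∨ᶠ ψ)  s = eval φ s ∨ eval ψ s

BN : ℕ → Set
BN n = Fin n → Form n

FixedPoint : ∀ {n} → BN n → State n → Set
FixedPoint {n} f s = (v : Fin n) → eval (f v) s ≡ lookup s v

data NNF (n : ℕ) : Set where
  lit  : Bool → Fin n → NNF n
  top  : NNF n
  bot  : NNF n
  _∧ⁿ_ : NNF n → NNF n → NNF n
  _∨ⁿ_ : NNF n → NNF n → NNF n

evalN : ∀ {n} → NNF n → State n → Bool
evalN (lit true v)  s = lookup s v
evalN (lit false v) s = not (lookup s v)
evalN top s = true
evalN bot s = false
evalN (φ ∧ⁿ ψ) s = evalN φ s ∧ evalN ψ s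
evalN (φ ∨ⁿ ψ) s = evalN φ s ∨ evalN ψ s

IsNNFs : ∀ {n} → BN n → (Fin n → NNF n × NNF n) → Set
IsNNFs {n} f Φ = (v : Fin n) → (s : State n) →
  (evalN (Data.Product.proj₁ (Φ v)) s ≡ eval (f v) s) ×
  (evalN (Data.Product.proj₂ (Φ v)) s ≡ not (eval (f v) s))

data Val : Set where
  v0 v1 ⋆ : Val

Phenotype : ℕ → Set
Phenotype n = List (Fin n × Val)

-- a state seen as a sub-space without ⋆
asSubspace : ∀ {n} → State n → Fin n → Val
asSubspace s v with lookup s v
... | true  = v1
... | false = v0

Satisfies : ∀ {n} → State n → Phenotype n → Set
Satisfies s β = All (λ { (v , e) → asSubspace s v ≡ e }) β

data Atom (n : ℕ) : Set where
  p   : Fin n → Atom n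
  nv  : Fin n → Atom n
  aux : ℕ → Atom n

record Rule (n : ℕ) : Set where
  constructor rule
  field
    head : List (Atom n)
    pos  : List (Atom n)
    neg  : List (Atom n)
open Rule public

Program : ℕ → Set
Program n = List (Rule n)

Interp : ℕ → Set
Interp n = Atom n → Bool

_∈ᴵ_ : ∀ {n} → Atom n → Interp n → Set
a ∈ᴵ M = M a ≡ true

SatRule : ∀ {n} → Interp n → Rule n → Set
SatRule M r = Any (λ a → M a ≡ true) (head r ++ neg r) ⊎ Any (λ a → M a ≡ false) (pos r)

Model : ∀ {n} → Interp n → Program n → Set
Model M P = All (SatRule M) P

allᵇ : ∀ {A : Set} → (A → Bool) → List A → Bool
allᵇ q [] = true
allᵇ q (x ∷ xs) = q x ∧ allᵇ q xs

reduct : ∀ {n} → Program n → Interp n → Program n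
reduct P M = map (λ r → rule (head r) (pos r) [])
                 (filterᵇ (λ r → allᵇ (λ a → not (M a)) (neg r)) P)

_⊆ᴵ_ : ∀ {n} → Interp n → Interp n → Set
N ⊆ᴵ M = ∀ a → a ∈ᴵ N → a ∈ᴵ M

-- M is a model of P and no proper subset of M is a model of P^M
-- (for decidable sets: every subset of M modelling P^M equals M)
AnswerSet : ∀ {n} → Interp n → Program n → Set
AnswerSet {n} M P = Model M P ×
  ((N : Interp n) → N ⊆ᴵ M → Model N (reduct P M) → M ⊆ᴵ N)

single : ∀ {n} → Atom n → List (Atom n) × List (Rule n) × ℕ → List (Rule n) × ℕ
single h (b , rs , k') = rule (h ∷ []) b [] ∷ rs , k'

mutual
  -- γ(φ) as a rule body, extra rules produced, next fresh index
  γ : ∀ {n} → NNF n → ℕ → List (Atom n) × List (Rule n) × ℕ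
  γ (lit true v)  k = p v ∷ [] , [] , k
  γ (lit false v) k = nv v ∷ [] , [] , k
  γ top k = [] , [] , k
  γ (φ ∧ⁿ ψ) k with γ φ k
  ... | b₁ , r₁ , k₁ with γ ψ k₁
  ... | b₂ , r₂ , k₂ = b₁ ++ b₂ , r₁ ++ r₂ , k₂
  γ bot k = aux k ∷ [] , [] , suc k
  γ (φ ∨ⁿ ψ) k with disj (aux k) φ (suc k)
  ... | r₁ , k₁ with disj (aux k) ψ k₁
  ... | r₂ , k₂ = aux k ∷ [] , r₁ ++ r₂ , k₂

  -- rules  h ← γ(α_j)  for the disjuncts α_j of a (flattened) disjunction
  disj : ∀ {n} → Atom n → NNF n → ℕ → List (Rule n) × ℕ
  disj h bot k = [] , k
  disj h (φ ∨ⁿ ψ) k with disj h φ k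
  ... | r₁ , k₁ with disj h ψ k₁
  ... | r₂ , k₂ = r₁ ++ r₂ , k₂
  disj h (lit b v) k = single h (γ (lit b v) k)
  disj h top k = single h (γ top k)
  disj h (φ ∧ⁿ ψ) k = single h (γ (φ ∧ⁿ ψ) k)

fASPvar : ∀ {n} → (Fin n → NNF n × NNF n) → Fin n → ℕ → List (Rule n) × ℕ
fASPvar Φ v k with γ (Data.Product.proj₁ (Φ v)) k
... | b⁺ , r⁺ , k₁ with γ (Data.Product.proj₂ (Φ v)) k₁
... | b⁻ , r⁻ , k₂ =
  (rule (p v ∷ nv v ∷ []) ([]) ([])) ∷
  (rule ([]) (p v ∷ nv v ∷ []) ([])) ∷
  (rule (p v ∷ []) (b⁺) ([])) ∷
  (rule (nv v ∷ []) (b⁻) ([])) ∷ r⁺ ++ r⁻ , k₂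

fASPlist : ∀ {n} → (Fin n → NNF n × NNF n) → List (Fin n) → ℕ → List (Rule n)
fASPlist Φ [] k = []
fASPlist Φ (v ∷ vs) k with fASPvar Φ v k
... | rs , k' = rs ++ fASPlist Φ vs k'

fASP : ∀ {n} → BN n → (Fin n → NNF n × NNF n) → Program n
fASP {n} f Φ = fASPlist Φ (allFin n) 0

toASPtrait : ∀ {n} → Fin n × Val → List (Rule n)
toASPtrait (v , v1) = (rule ([]) ([]) ((p v ∷ []))) ∷ (rule ([]) (nv v ∷ []) ([])) ∷ []
toASPtrait (v , v0) = (rule ([]) (p v ∷ []) ([])) ∷ (rule ([]) ([]) ((nv v ∷ []))) ∷ []
toASPtrait (v , ⋆)  = (rule ([]) ([]) ((p v ∷ []))) ∷ (rule ([]) ([]) ((nv v ∷ []))) ∷ []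

toASP : ∀ {n} → Phenotype n → Program n
toASP β = concatMap toASPtrait β

stateOf : ∀ {n} → Interp n → State n
stateOf M = tabulate (λ v → M (p v))

-- A model of fASP(f) contains exactly one of p_v, n_v for each v, so it encodes the state
-- s_v = [p_v ∈ M]. The auxiliary atom of every true disjunction in γ(Φ) is forced true, so the
-- body γ(Φ±_v) holds whenever Φ±_v does, and the rules p_v ← γ(Φ⁺_v), n_v ← γ(Φ⁻_v) make s a
-- fixed point. Conversely, for a fixed point s let canonical s encode s and make each auxiliary
-- atom true iff its disjunction holds at s. The fresh indices handed out by γ form consecutive
-- intervals, so this valuation can be checked one formula occurrence at a time: it is a model,
-- and it lies below every model of the negation-free rules that encodes s, which is minimality.
-- As answer sets are minimal models, every answer set encoding s equals canonical s.
module Submission where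

open import Defs
open import Data.Nat using (ℕ; suc; _≤_; _<_; _≡ᵇ_)
open import Data.Nat.Properties using (≤-refl; ≤-trans; <-≤-trans; n≤1+n; <-irrefl; ≡ᵇ⇒≡; ≡⇒≡ᵇ)
open import Data.Bool using (Bool; true; false; not; _∧_; _∨_)
open import Data.Bool.Properties using (∨-identityʳ; ∨-zeroʳ; ∧-identityʳ; ∧-conicalˡ; ∧-conicalʳ; not-involutive; not-injective; T-≡)
open import Data.Fin using (Fin)
open import Data.Vec using (lookup; tabulate)
open import Data.Vec.Properties using (lookup∘tabulate; tabulate∘lookup)
open import Data.List using (List; []; _∷_; _++_; allFin)
open import Data.List.Relation.Unary.All using (All; []; _∷_; lookupAny) renaming (map to allMap; head to allHead; tail to allTail)
open import Data.List.Relation.Unary.Any using (Any; here; there) renaming (map to anyMap)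
import Data.List.Relation.Unary.All.Properties as All
import Data.List.Relation.Unary.Any.Properties as Any
open import Data.List.Membership.Propositional using (_∈_)
open import Data.List.Membership.Propositional.Properties using (∈-allFin)
open import Data.Product using (_×_; Σ; ∃; _,_; proj₁; proj₂)
open import Data.Sum using (_⊎_; inj₁; inj₂)
open import Data.Empty using (⊥-elim)
open import Function using (_∘_)
open import Function.Bundles using (Equivalence)
open import Relation.Binary.PropositionalEquality using (_≡_; refl; sym; trans; cong; cong₂)

∨-true⁻ : ∀ a b → a ∨ b ≡ true → a ≡ true ⊎ b ≡ true
∨-true⁻ true  _ _ = inj₁ refl
∨-true⁻ false _ e = inj₂ e

∨-trueˡ : ∀ {a} b → a ≡ true → a ∨ b ≡ true
∨-trueˡ b refl = refl

∨-trueʳ : ∀ a {b} → b ≡ true → a ∨ b ≡ true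
∨-trueʳ a refl = ∨-zeroʳ a

contradictionᵇ : ∀ {b} → b ≡ true → b ≡ false → ∀ {A : Set} → A
contradictionᵇ refl ()

⇔⇒≡ : ∀ {a b} → (a ≡ true → b ≡ true) → (b ≡ true → a ≡ true) → a ≡ b
⇔⇒≡ {true}  a⇒b _   = sym (a⇒b refl)
⇔⇒≡ {false} {true}  _ b⇒a = b⇒a refl
⇔⇒≡ {false} {false} _ _   = refl

complementary : ∀ {a b} → a ≡ true ⊎ b ≡ true → a ≡ false ⊎ b ≡ false → b ≡ not a
complementary {true}  {false} _ _ = refl
complementary {false} {true}  _ _ = refl
complementary {true}  {true}  _ (inj₁ ())
complementary {true}  {true}  _ (inj₂ ())
complementary {false} {false} (inj₁ ()) _
complementary {false} {false} (inj₂ ()) _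

one-true : ∀ {a b} l → a ≡ l → b ≡ not l → a ≡ true ⊎ b ≡ true
one-true true  a≡ _  = inj₁ a≡
one-true false _  b≡ = inj₂ b≡

one-false : ∀ {a b} l → a ≡ l → b ≡ not l → a ≡ false ⊎ b ≡ false
one-false true  _  b≡ = inj₂ b≡
one-false false a≡ _  = inj₁ a≡

choice-within : ∀ {a b} l → a ≡ true ⊎ b ≡ true → (a ≡ true → l ≡ true) → (b ≡ true → not l ≡ true) →
                a ≡ l × b ≡ not l
choice-within {true}  {true}  true  _ _ b⇒ = contradictionᵇ (b⇒ refl) refl
choice-within {true}  {true}  false _ a⇒ _ = contradictionᵇ (a⇒ refl) refl
choice-within {true}  {false} true  _ _ _  = refl , refl
choice-within {false} {true}  false _ _ _  = refl , refl
choice-within {true}  {false} false _ a⇒ _ = contradictionᵇ (a⇒ refl) refl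
choice-within {false} {true}  true  _ _ b⇒ = contradictionᵇ (b⇒ refl) refl
choice-within {false} {false} _     (inj₁ ()) _ _
choice-within {false} {false} _     (inj₂ ()) _ _


module _ {A : Set} (q : A → Bool) where

  allᵇ-++ : ∀ xs ys → allᵇ q (xs ++ ys) ≡ allᵇ q xs ∧ allᵇ q ys
  allᵇ-++ []       ys = refl
  allᵇ-++ (x ∷ xs) ys with q x
  ... | true  = allᵇ-++ xs ys
  ... | false = refl

  allᵇ-true⁻ : ∀ {xs} → allᵇ q xs ≡ true → All (λ a → q a ≡ true) xs
  allᵇ-true⁻ {[]}     _ = []
  allᵇ-true⁻ {x ∷ xs} e = ∧-conicalˡ (q x) _ e ∷ allᵇ-true⁻ (∧-conicalʳ (q x) _ e)

  allᵇ-false⁻ : ∀ {xs} → allᵇ q xs ≡ false → Any (λ a → q a ≡ false) xs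
  allᵇ-false⁻ {x ∷ xs} e with q x in qx
  ... | true  = there (allᵇ-false⁻ e)
  ... | false = here qx

  allᵇ-contradiction : ∀ {xs} → allᵇ q xs ≡ true → Any (λ a → q a ≡ false) xs → ∀ {B : Set} → B
  allᵇ-contradiction e any with lookupAny (allᵇ-true⁻ e) any
  ... | t , f = contradictionᵇ t f

module _ {n : ℕ} {M : Interp n} {h : Atom n} {b : List (Atom n)} where

  SatRule-definite⁺ : (allᵇ M b ≡ true → M h ≡ true) → SatRule M (rule (h ∷ []) b [])
  SatRule-definite⁺ fires with allᵇ M b in eq
  ... | true  = inj₁ (here (fires refl))
  ... | false = inj₂ (allᵇ-false⁻ M eq)

  SatRule-definite⁻ : SatRule M (rule (h ∷ []) b []) → allᵇ M b ≡ true → M h ≡ true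
  SatRule-definite⁻ (inj₁ (here e)) _ = e
  SatRule-definite⁻ (inj₂ any)      t = allᵇ-contradiction M t any

module _ {n : ℕ} {M : Interp n} {a b : Atom n} where

  SatRule-choice⁺ : M a ≡ true ⊎ M b ≡ true → SatRule M (rule (a ∷ b ∷ []) [] [])
  SatRule-choice⁺ (inj₁ Ma) = inj₁ (here Ma)
  SatRule-choice⁺ (inj₂ Mb) = inj₁ (there (here Mb))

  SatRule-choice⁻ : SatRule M (rule (a ∷ b ∷ []) [] []) → M a ≡ true ⊎ M b ≡ true
  SatRule-choice⁻ (inj₁ (here Ma))         = inj₁ Ma
  SatRule-choice⁻ (inj₁ (there (here Mb))) = inj₂ Mb

  SatRule-exclusion⁺ : M a ≡ false ⊎ M b ≡ false → SatRule M (rule [] (a ∷ b ∷ []) [])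
  SatRule-exclusion⁺ (inj₁ Ma) = inj₂ (here Ma)
  SatRule-exclusion⁺ (inj₂ Mb) = inj₂ (there (here Mb))

  SatRule-exclusion⁻ : SatRule M (rule [] (a ∷ b ∷ []) []) → M a ≡ false ⊎ M b ≡ false
  SatRule-exclusion⁻ (inj₂ (here Ma))         = inj₁ Ma
  SatRule-exclusion⁻ (inj₂ (there (here Mb))) = inj₂ Mb

module _ {n : ℕ} {M : Interp n} {a : Atom n} where

  SatRule-forbid⁺ : M a ≡ false → SatRule M (rule [] (a ∷ []) [])
  SatRule-forbid⁺ Ma = inj₂ (here Ma)

  SatRule-forbid⁻ : SatRule M (rule [] (a ∷ []) []) → M a ≡ false
  SatRule-forbid⁻ (inj₂ (here Ma)) = Ma

  SatRule-require⁺ : M a ≡ true → SatRule M (rule [] [] (a ∷ []))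
  SatRule-require⁺ Ma = inj₁ (here Ma)

  SatRule-require⁻ : SatRule M (rule [] [] (a ∷ [])) → M a ≡ true
  SatRule-require⁻ (inj₁ (here Ma)) = Ma

module _ {n : ℕ} where

  ModelOfNegationFree : Interp n → Program n → Set
  ModelOfNegationFree N P = All (λ r → neg r ≡ [] → SatRule N r) P

  model⇒negationFree : ∀ {M P} → Model M P → ModelOfNegationFree M P
  model⇒negationFree = allMap (λ sat _ → sat)

  reduct⇒negationFree : ∀ {M N} P → Model N (reduct P M) → ModelOfNegationFree N P
  reduct⇒negationFree [] _ = []
  reduct⇒negationFree {M} (rule h b [] ∷ P) (sat ∷ m) = (λ _ → sat) ∷ reduct⇒negationFree {M} P m
  reduct⇒negationFree {M} (rule h b (c ∷ cs) ∷ P) m with allᵇ (λ a → not (M a)) (c ∷ cs)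
  ... | true  = (λ ()) ∷ reduct⇒negationFree {M} P (allTail m)
  ... | false = (λ ()) ∷ reduct⇒negationFree {M} P m

  ⊆-model⇒reduct-model : ∀ {C M : Interp n} → C ⊆ᴵ M → ∀ P → Model C P → Model C (reduct P M)
  ⊆-model⇒reduct-model _ [] _ = []
  ⊆-model⇒reduct-model {C} {M} sub (rule h b c ∷ P) (sat ∷ m) with allᵇ (λ a → not (M a)) c in keep
  ... | true  = reduced sat ∷ ⊆-model⇒reduct-model sub P m
    where
      reduced : SatRule C (rule h b c) → SatRule C (rule h b [])
      reduced (inj₂ pos) = inj₂ pos
      reduced (inj₁ hn) with Any.++⁻ h hn
      ... | inj₁ hd = inj₁ (Any.++⁺ˡ hd)
      ... | inj₂ ng = allᵇ-contradiction (λ a → not (M a)) keep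
                        (anyMap (λ {a} Ca → cong not (sub a Ca)) ng)
  ... | false = ⊆-model⇒reduct-model sub P m

  answerSet-minimal : ∀ {M C : Interp n} {P} → AnswerSet M P → C ⊆ᴵ M → Model C P → M ⊆ᴵ C
  answerSet-minimal {P = P} (_ , least) sub model = least _ sub (⊆-model⇒reduct-model sub P model)

Supported : (ℕ → Bool) → ℕ → ℕ → Set
Supported F lo hi = ∀ j → F j ≡ true → lo ≤ j × j < hi

AgreesOn : (ℕ → Bool) → (ℕ → Bool) → ℕ → ℕ → Set
AgreesOn A F lo hi = ∀ j → lo ≤ j → j < hi → A j ≡ F j

AgreesFrom : (ℕ → Bool) → (ℕ → Bool) → ℕ → Set
AgreesFrom A F lo = ∀ j → lo ≤ j → A j ≡ F j

module _ {F : ℕ → Bool} {lo mid : ℕ} where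

  supported-below : Supported F lo mid → ∀ {j} → j < lo → F j ≡ false
  supported-below supp {j} j<lo with F j in Fj
  ... | true  = ⊥-elim (<-irrefl refl (<-≤-trans j<lo (proj₁ (supp j Fj))))
  ... | false = refl

  supported-above : Supported F lo mid → ∀ {j} → mid ≤ j → F j ≡ false
  supported-above supp {j} mid≤j with F j in Fj
  ... | true  = ⊥-elim (<-irrefl refl (<-≤-trans (proj₂ (supp j Fj)) mid≤j))
  ... | false = refl

module _ {F G : ℕ → Bool} {lo mid : ℕ} (lo≤mid : lo ≤ mid) where

  module _ {hi : ℕ} (mid≤hi : mid ≤ hi) where

    supported-∨-adjacent : Supported F lo mid → Supported G mid hi → Supported (λ j → F j ∨ G j) lo hi
    supported-∨-adjacent suppF suppG j e with ∨-true⁻ (F j) (G j) e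
    ... | inj₁ Fj = proj₁ (suppF j Fj) , <-≤-trans (proj₂ (suppF j Fj)) mid≤hi
    ... | inj₂ Gj = ≤-trans lo≤mid (proj₁ (suppG j Gj)) , proj₂ (suppG j Gj)

    agrees-∨-adjacent : ∀ {A} → Supported F lo mid → Supported G mid hi →
      AgreesOn A (λ j → F j ∨ G j) lo hi → AgreesOn A F lo mid × AgreesOn A G mid hi
    agrees-∨-adjacent {A} suppF suppG agree = agreeF , agreeG
      where
        agreeF : AgreesOn A F lo mid
        agreeF j lo≤j j<mid =
          trans (agree j lo≤j (<-≤-trans j<mid mid≤hi))
                (trans (cong (F j ∨_) (supported-below suppG j<mid)) (∨-identityʳ (F j)))
        agreeG : AgreesOn A G mid hi
        agreeG j mid≤j j<hi =
          trans (agree j (≤-trans lo≤mid mid≤j) j<hi) (cong (_∨ G j) (supported-above suppF mid≤j))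

  agreesFrom-∨-adjacent : ∀ {A} → Supported F lo mid → (∀ {j} → j < mid → G j ≡ false) →
    AgreesFrom A (λ j → F j ∨ G j) lo → AgreesOn A F lo mid × AgreesFrom A G mid
  agreesFrom-∨-adjacent {A} suppF G-below agree = agreeF , agreeG
    where
      agreeF : AgreesOn A F lo mid
      agreeF j lo≤j j<mid =
        trans (agree j lo≤j) (trans (cong (F j ∨_) (G-below j<mid)) (∨-identityʳ (F j)))
      agreeG : AgreesFrom A G mid
      agreeG j mid≤j = trans (agree j (≤-trans lo≤mid mid≤j)) (cong (_∨ G j) (supported-above suppF mid≤j))

point : ℕ → Bool → ℕ → Bool
point k b j = (j ≡ᵇ k) ∧ b

point-true : ∀ {k b j} → point k b j ≡ true → j ≡ k × b ≡ true
point-true {k} {b} {j} e = ≡ᵇ⇒≡ j k (Equivalence.from T-≡ (∧-conicalˡ _ b e)) , ∧-conicalʳ _ b e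

point-supported : ∀ k b → Supported (point k b) k (suc k)
point-supported k b j e with point-true {k} {b} {j} e
... | refl , _ = ≤-refl , ≤-refl

point-at : ∀ k b → point k b k ≡ b
point-at k b = cong (_∧ b) (Equivalence.to T-≡ (≡⇒≡ᵇ k k refl))

module _ {n : ℕ} where

  bodyγ : NNF n → ℕ → List (Atom n)
  bodyγ φ k = proj₁ (γ φ k)

  rulesγ : NNF n → ℕ → Program n
  rulesγ φ k = proj₁ (proj₂ (γ φ k))

  nextγ : NNF n → ℕ → ℕ
  nextγ φ k = proj₂ (proj₂ (γ φ k))

  rulesᵈ : Atom n → NNF n → ℕ → Program n
  rulesᵈ h φ k = proj₁ (disj h φ k)

  nextᵈ : Atom n → NNF n → ℕ → ℕ
  nextᵈ h φ k = proj₂ (disj h φ k)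

  -- γ (φ ∨ⁿ ψ) k reduces to (aux k ∷ [] , disj (aux k) (φ ∨ⁿ ψ) (suc k)); the ᵈ∨ lemmas treat that
  -- case by recursing on φ and ψ separately, which keeps the mutual recursions structural.
  mutual
    k≤nextγ : ∀ φ k → k ≤ nextγ φ k
    k≤nextγ (lit true  v) k = ≤-refl
    k≤nextγ (lit false v) k = ≤-refl
    k≤nextγ top       k = ≤-refl
    k≤nextγ bot       k = n≤1+n k
    k≤nextγ (φ ∧ⁿ ψ)  k = ≤-trans (k≤nextγ φ k) (k≤nextγ ψ _)
    k≤nextγ (φ ∨ⁿ ψ)  k = ≤-trans (n≤1+n k) (k≤nextᵈ∨ (aux k) φ ψ (suc k))

    k≤nextᵈ : ∀ h φ k → k ≤ nextᵈ h φ k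
    k≤nextᵈ h bot       k = ≤-refl
    k≤nextᵈ h (φ ∨ⁿ ψ)  k = k≤nextᵈ∨ h φ ψ k
    k≤nextᵈ h (lit b v) k = k≤nextγ (lit b v) k
    k≤nextᵈ h top       k = ≤-refl
    k≤nextᵈ h (φ ∧ⁿ ψ)  k = k≤nextγ (φ ∧ⁿ ψ) k

    k≤nextᵈ∨ : ∀ h φ ψ k → k ≤ nextᵈ h (φ ∨ⁿ ψ) k
    k≤nextᵈ∨ h φ ψ k = ≤-trans (k≤nextᵈ h φ k) (k≤nextᵈ h ψ _)

Encodes : ∀ {n} → Interp n → State n → Set
Encodes {n} C s = (v : Fin n) → C (p v) ≡ lookup s v × C (nv v) ≡ not (lookup s v)

module Evaluation {n : ℕ} (s : State n) where

  -- The value at s of the auxiliary atoms introduced by γ φ k: the atom of a disjunction occurrence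
  -- holds iff the disjunction does, and the atom introduced for bot has no rule, so it stays false.
  mutual
    auxγ : NNF n → ℕ → ℕ → Bool
    auxγ (lit _ _) _ _ = false
    auxγ top       _ _ = false
    auxγ bot       _ _ = false
    auxγ (φ ∧ⁿ ψ)  k j = auxγ φ k j ∨ auxγ ψ (nextγ φ k) j
    auxγ (φ ∨ⁿ ψ)  k j = point k (evalN (φ ∨ⁿ ψ) s) j ∨ auxᵈ (aux k) (φ ∨ⁿ ψ) (suc k) j

    auxᵈ : Atom n → NNF n → ℕ → ℕ → Bool
    auxᵈ h bot       _ _ = false
    auxᵈ h (φ ∨ⁿ ψ)  k j = auxᵈ h φ k j ∨ auxᵈ h ψ (nextᵈ h φ k) j
    auxᵈ h (lit _ _) _ _ = false
    auxᵈ h top       _ _ = false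
    auxᵈ h (φ ∧ⁿ ψ)  k j = auxγ φ k j ∨ auxγ ψ (nextγ φ k) j

  mutual
    auxγ-supported : ∀ φ k → Supported (auxγ φ k) k (nextγ φ k)
    auxγ-supported (lit _ _) k _ ()
    auxγ-supported top       k _ ()
    auxγ-supported bot       k _ ()
    auxγ-supported (φ ∧ⁿ ψ)  k = supported-∨-adjacent (k≤nextγ φ k) (k≤nextγ ψ _)
      (auxγ-supported φ k) (auxγ-supported ψ _)
    auxγ-supported (φ ∨ⁿ ψ)  k = supported-∨-adjacent (n≤1+n k) (k≤nextᵈ∨ (aux k) φ ψ (suc k))
      (point-supported k _) (auxᵈ∨-supported (aux k) φ ψ (suc k))

    auxᵈ-supported : ∀ h φ k → Supported (auxᵈ h φ k) k (nextᵈ h φ k)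
    auxᵈ-supported h bot       k _ ()
    auxᵈ-supported h (φ ∨ⁿ ψ)  k = auxᵈ∨-supported h φ ψ k
    auxᵈ-supported h (lit _ _) k _ ()
    auxᵈ-supported h top       k _ ()
    auxᵈ-supported h (φ ∧ⁿ ψ)  k = auxγ-supported (φ ∧ⁿ ψ) k

    auxᵈ∨-supported : ∀ h φ ψ k → Supported (auxᵈ h (φ ∨ⁿ ψ) k) k (nextᵈ h (φ ∨ⁿ ψ) k)
    auxᵈ∨-supported h φ ψ k = supported-∨-adjacent (k≤nextᵈ h φ k) (k≤nextᵈ h ψ _)
      (auxᵈ-supported h φ k) (auxᵈ-supported h ψ _)

  module _ {C : Interp n} (encodes : Encodes C s) where

    literal-body : ∀ b v k → allᵇ C (bodyγ (lit b v) k) ≡ evalN (lit b v) s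
    literal-body true  v k = trans (∧-identityʳ _) (proj₁ (encodes v))
    literal-body false v k = trans (∧-identityʳ _) (proj₂ (encodes v))

    mutual
      bodyγ-holds : ∀ φ k → ModelOfNegationFree C (rulesγ φ k) → evalN φ s ≡ true →
                    allᵇ C (bodyγ φ k) ≡ true
      bodyγ-holds (lit b v) k _ e = trans (literal-body b v k) e
      bodyγ-holds top       k _ _ = refl
      bodyγ-holds bot       k _ ()
      bodyγ-holds (φ ∧ⁿ ψ)  k m e = trans (allᵇ-++ C (bodyγ φ k) _) (cong₂ _∧_
        (bodyγ-holds φ k (All.++⁻ˡ (rulesγ φ k) m) (∧-conicalˡ _ _ e))
        (bodyγ-holds ψ _ (All.++⁻ʳ (rulesγ φ k) m) (∧-conicalʳ _ _ e)))
      bodyγ-holds (φ ∨ⁿ ψ)  k m e = trans (∧-identityʳ _) (rulesᵈ∨-head (aux k) φ ψ (suc k) m e)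

      rulesᵈ-head : ∀ h φ k → ModelOfNegationFree C (rulesᵈ h φ k) → evalN φ s ≡ true → C h ≡ true
      rulesᵈ-head h bot       k _ ()
      rulesᵈ-head h (φ ∨ⁿ ψ)  k m       e = rulesᵈ∨-head h φ ψ k m e
      rulesᵈ-head h (lit b v) k (r ∷ m) e = SatRule-definite⁻ (r refl) (bodyγ-holds (lit b v) k m e)
      rulesᵈ-head h top       k (r ∷ m) e = SatRule-definite⁻ (r refl) (bodyγ-holds top k m e)
      rulesᵈ-head h (φ ∧ⁿ ψ)  k (r ∷ m) e = SatRule-definite⁻ (r refl) (bodyγ-holds (φ ∧ⁿ ψ) k m e)

      rulesᵈ∨-head : ∀ h φ ψ k → ModelOfNegationFree C (rulesᵈ h (φ ∨ⁿ ψ) k) →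
                     evalN (φ ∨ⁿ ψ) s ≡ true → C h ≡ true
      rulesᵈ∨-head h φ ψ k m e with ∨-true⁻ (evalN φ s) _ e
      ... | inj₁ φ-true = rulesᵈ-head h φ k (All.++⁻ˡ (rulesᵈ h φ k) m) φ-true
      ... | inj₂ ψ-true = rulesᵈ-head h ψ _ (All.++⁻ʳ (rulesᵈ h φ k) m) ψ-true

    mutual
      auxγ-derived : ∀ φ k j → ModelOfNegationFree C (rulesγ φ k) → auxγ φ k j ≡ true → C (aux j) ≡ true
      auxγ-derived (lit _ _) k j _ ()
      auxγ-derived top       k j _ ()
      auxγ-derived bot       k j _ ()
      auxγ-derived (φ ∧ⁿ ψ)  k j m e with ∨-true⁻ (auxγ φ k j) _ e
      ... | inj₁ eφ = auxγ-derived φ k j (All.++⁻ˡ (rulesγ φ k) m) eφ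
      ... | inj₂ eψ = auxγ-derived ψ _ j (All.++⁻ʳ (rulesγ φ k) m) eψ
      auxγ-derived (φ ∨ⁿ ψ)  k j m e with ∨-true⁻ (point k (evalN (φ ∨ⁿ ψ) s) j) _ e
      ... | inj₂ eᵈ = auxᵈ∨-derived (aux k) φ ψ (suc k) j m eᵈ
      ... | inj₁ e-point with point-true {k} {_} {j} e-point
      ...   | refl , holds = rulesᵈ∨-head (aux k) φ ψ (suc k) m holds

      auxᵈ-derived : ∀ h φ k j → ModelOfNegationFree C (rulesᵈ h φ k) → auxᵈ h φ k j ≡ true →
                     C (aux j) ≡ true
      auxᵈ-derived h bot       k j _       ()
      auxᵈ-derived h (φ ∨ⁿ ψ)  k j m       e = auxᵈ∨-derived h φ ψ k j m e
      auxᵈ-derived h (lit _ _) k j _       ()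
      auxᵈ-derived h top       k j _       ()
      auxᵈ-derived h (φ ∧ⁿ ψ)  k j (_ ∷ m) e = auxγ-derived (φ ∧ⁿ ψ) k j m e

      auxᵈ∨-derived : ∀ h φ ψ k j → ModelOfNegationFree C (rulesᵈ h (φ ∨ⁿ ψ) k) →
                      auxᵈ h (φ ∨ⁿ ψ) k j ≡ true → C (aux j) ≡ true
      auxᵈ∨-derived h φ ψ k j m e with ∨-true⁻ (auxᵈ h φ k j) _ e
      ... | inj₁ eφ = auxᵈ-derived h φ k j (All.++⁻ˡ (rulesᵈ h φ k) m) eφ
      ... | inj₂ eψ = auxᵈ-derived h ψ _ j (All.++⁻ʳ (rulesᵈ h φ k) m) eψ

    Agreesγ : NNF n → ℕ → Set
    Agreesγ φ k = AgreesOn (C ∘ aux) (auxγ φ k) k (nextγ φ k)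

    Agreesᵈ : Atom n → NNF n → ℕ → Set
    Agreesᵈ h φ k = AgreesOn (C ∘ aux) (auxᵈ h φ k) k (nextᵈ h φ k)

    agreesγ-∧ : ∀ φ ψ k → Agreesγ (φ ∧ⁿ ψ) k → Agreesγ φ k × Agreesγ ψ (nextγ φ k)
    agreesγ-∧ φ ψ k = agrees-∨-adjacent (k≤nextγ φ k) (k≤nextγ ψ _) (auxγ-supported φ k) (auxγ-supported ψ _)

    agreesγ-∨ : ∀ φ ψ k → Agreesγ (φ ∨ⁿ ψ) k →
                C (aux k) ≡ evalN (φ ∨ⁿ ψ) s × Agreesᵈ (aux k) (φ ∨ⁿ ψ) (suc k)
    agreesγ-∨ φ ψ k agree with agrees-∨-adjacent (n≤1+n k) (k≤nextᵈ∨ (aux k) φ ψ (suc k))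
                                 (point-supported k _) (auxᵈ∨-supported (aux k) φ ψ (suc k)) agree
    ... | agree-point , agreeᵈ = trans (agree-point k ≤-refl ≤-refl) (point-at k _) , agreeᵈ

    agreesᵈ-∨ : ∀ h φ ψ k → Agreesᵈ h (φ ∨ⁿ ψ) k → Agreesᵈ h φ k × Agreesᵈ h ψ (nextᵈ h φ k)
    agreesᵈ-∨ h φ ψ k = agrees-∨-adjacent (k≤nextᵈ h φ k) (k≤nextᵈ h ψ _) (auxᵈ-supported h φ k) (auxᵈ-supported h ψ _)

    bodyγ-value : ∀ φ k → Agreesγ φ k → allᵇ C (bodyγ φ k) ≡ evalN φ s
    bodyγ-value (lit b v) k _     = literal-body b v k
    bodyγ-value top       k _     = refl
    bodyγ-value bot       k agree = trans (∧-identityʳ _) (agree k ≤-refl ≤-refl)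
    bodyγ-value (φ ∧ⁿ ψ)  k agree with agreesγ-∧ φ ψ k agree
    ... | agreeφ , agreeψ = trans (allᵇ-++ C (bodyγ φ k) _)
                                  (cong₂ _∧_ (bodyγ-value φ k agreeφ) (bodyγ-value ψ _ agreeψ))
    bodyγ-value (φ ∨ⁿ ψ)  k agree = trans (∧-identityʳ _) (proj₁ (agreesγ-∨ φ ψ k agree))

    mutual
      rulesγ-model : ∀ φ k → Agreesγ φ k → Model C (rulesγ φ k)
      rulesγ-model (lit true  _) k _ = []
      rulesγ-model (lit false _) k _ = []
      rulesγ-model top           k _ = []
      rulesγ-model bot           k _ = []
      rulesγ-model (φ ∧ⁿ ψ) k agree with agreesγ-∧ φ ψ k agree
      ... | agreeφ , agreeψ = All.++⁺ (rulesγ-model φ k agreeφ) (rulesγ-model ψ _ agreeψ)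
      rulesγ-model (φ ∨ⁿ ψ) k agree with agreesγ-∨ φ ψ k agree
      ... | aux-value , agreeᵈ = rulesᵈ∨-model (aux k) φ ψ (suc k) agreeᵈ (trans aux-value)

      rulesᵈ-model : ∀ h φ k → Agreesᵈ h φ k → (evalN φ s ≡ true → C h ≡ true) → Model C (rulesᵈ h φ k)
      rulesᵈ-model h bot       k _     _    = []
      rulesᵈ-model h (φ ∨ⁿ ψ)  k agree head = rulesᵈ∨-model h φ ψ k agree head
      rulesᵈ-model h (lit b v) k agree head = definite-model h (lit b v) k agree head
      rulesᵈ-model h top       k agree head = definite-model h top k agree head
      rulesᵈ-model h (φ ∧ⁿ ψ)  k agree head = definite-model h (φ ∧ⁿ ψ) k agree head

      rulesᵈ∨-model : ∀ h φ ψ k → Agreesᵈ h (φ ∨ⁿ ψ) k → (evalN (φ ∨ⁿ ψ) s ≡ true → C h ≡ true) →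
                      Model C (rulesᵈ h (φ ∨ⁿ ψ) k)
      rulesᵈ∨-model h φ ψ k agree head with agreesᵈ-∨ h φ ψ k agree
      ... | agreeφ , agreeψ = All.++⁺ (rulesᵈ-model h φ k agreeφ (head ∘ ∨-trueˡ _))
                                      (rulesᵈ-model h ψ _ agreeψ (head ∘ ∨-trueʳ _))

      definite-model : ∀ h φ k → Agreesγ φ k → (evalN φ s ≡ true → C h ≡ true) →
                       Model C (rule (h ∷ []) (bodyγ φ k) [] ∷ rulesγ φ k)
      definite-model h φ k agree head =
        SatRule-definite⁺ (head ∘ trans (sym (bodyγ-value φ k agree))) ∷ rulesγ-model φ k agree

val : Bool → Val
val true  = v1
val false = v0

asSubspace≡val : ∀ {n} (s : State n) v → asSubspace s v ≡ val (lookup s v)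
asSubspace≡val s v with lookup s v
... | true  = refl
... | false = refl

module _ {n : ℕ} {M : Interp n} (s : State n) (encodes : Encodes M s) where

  trait-satisfied : ∀ v e → Model M (toASPtrait (v , e)) → asSubspace s v ≡ e
  trait-satisfied v e rules =
    trans (asSubspace≡val s v) (from-rules (lookup s v) e (proj₁ (encodes v)) (proj₂ (encodes v)) rules)
    where
      from-rules : ∀ b e → M (p v) ≡ b → M (nv v) ≡ not b → Model M (toASPtrait (v , e)) → val b ≡ e
      from-rules true  v1 _  _   _              = refl
      from-rules false v0 _  _   _              = refl
      from-rules true  v0 p≡ _   (r₁ ∷ _)       = contradictionᵇ p≡ (SatRule-forbid⁻ r₁)
      from-rules false v1 p≡ _   (r₁ ∷ _)       = contradictionᵇ (SatRule-require⁻ r₁) p≡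
      from-rules true  ⋆  _  nv≡ (_ ∷ r₂ ∷ [])  = contradictionᵇ (SatRule-require⁻ r₂) nv≡
      from-rules false ⋆  p≡ _   (r₁ ∷ _)       = contradictionᵇ (SatRule-require⁻ r₁) p≡

  toASP-satisfied : ∀ β → Model M (toASP β) → Satisfies s β
  toASP-satisfied []            _     = []
  toASP-satisfied ((v , e) ∷ β) model =
    trait-satisfied v e (All.++⁻ˡ (toASPtrait (v , e)) model) ∷
    toASP-satisfied β (All.++⁻ʳ (toASPtrait (v , e)) model)

  trait-model : ∀ v e → asSubspace s v ≡ e → Model M (toASPtrait (v , e))
  trait-model v e sat =
    to-rules (lookup s v) e (proj₁ (encodes v)) (proj₂ (encodes v)) (trans (sym (asSubspace≡val s v)) sat)
    where
      to-rules : ∀ b e → M (p v) ≡ b → M (nv v) ≡ not b → val b ≡ e → Model M (toASPtrait (v , e))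
      to-rules true  .v1 p≡ nv≡ refl = SatRule-require⁺ p≡ ∷ SatRule-forbid⁺ nv≡ ∷ []
      to-rules false .v0 p≡ nv≡ refl = SatRule-forbid⁺ p≡ ∷ SatRule-require⁺ nv≡ ∷ []

  toASP-model : ∀ β → Satisfies s β → Model M (toASP β)
  toASP-model []            []           = []
  toASP-model ((v , e) ∷ β) (sat ∷ sats) = All.++⁺ (trait-model v e sat) (toASP-model β sats)

module Network {n : ℕ} (f : BN n) (Φ : Fin n → NNF n × NNF n) (nnf : IsNNFs f Φ) where

  Φ⁺ Φ⁻ : Fin n → NNF n
  Φ⁺ v = proj₁ (Φ v)
  Φ⁻ v = proj₂ (Φ v)

  varRules : Fin n → ℕ → Program n
  varRules v k = proj₁ (fASPvar Φ v k)

  nextᵛ : Fin n → ℕ → ℕ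
  nextᵛ v k = proj₂ (fASPvar Φ v k)

  k≤nextᵛ : ∀ v k → k ≤ nextᵛ v k
  k≤nextᵛ v k = ≤-trans (k≤nextγ (Φ⁺ v) k) (k≤nextγ (Φ⁻ v) _)

  varRules-∈ : ∀ {Q : Rule n → Set} {v} vs k → All Q (fASPlist Φ vs k) → v ∈ vs → ∃ λ k′ → All Q (varRules v k′)
  varRules-∈ (w ∷ vs) k rules (here refl) = k , All.++⁻ˡ (varRules w k) rules
  varRules-∈ (w ∷ vs) k rules (there v∈) = varRules-∈ vs _ (All.++⁻ʳ (varRules w k) rules) v∈

  fASP-varRules : ∀ {Q : Rule n → Set} → All Q (fASP f Φ) → ∀ v → ∃ λ k → All Q (varRules v k)
  fASP-varRules rules v = varRules-∈ (allFin n) 0 rules (∈-allFin v)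

  fASP-complementary : ∀ {M} → ModelOfNegationFree M (fASP f Φ) → ∀ v → M (nv v) ≡ not (M (p v))
  fASP-complementary model v with fASP-varRules model v
  ... | _ , (choice ∷ exclusion ∷ _) = complementary (SatRule-choice⁻ (choice refl)) (SatRule-exclusion⁻ (exclusion refl))

  fASP-encodes : ∀ {M} → ModelOfNegationFree M (fASP f Φ) → Encodes M (stateOf M)
  fASP-encodes {M} model v = sym p≡ , trans (fASP-complementary model v) (cong not (sym p≡))
    where
      p≡ : lookup (stateOf M) v ≡ M (p v)
      p≡ = lookup∘tabulate (λ w → M (p w)) v

  module _ (s : State n) where
    open Evaluation s

    auxᵛ : Fin n → ℕ → ℕ → Bool
    auxᵛ v k j = auxγ (Φ⁺ v) k j ∨ auxγ (Φ⁻ v) (nextγ (Φ⁺ v) k) j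

    auxˡ : List (Fin n) → ℕ → ℕ → Bool
    auxˡ []       k j = false
    auxˡ (v ∷ vs) k j = auxᵛ v k j ∨ auxˡ vs (nextᵛ v k) j

    auxᵛ-supported : ∀ v k → Supported (auxᵛ v k) k (nextᵛ v k)
    auxᵛ-supported v k = supported-∨-adjacent (k≤nextγ (Φ⁺ v) k) (k≤nextγ (Φ⁻ v) _)
      (auxγ-supported (Φ⁺ v) k) (auxγ-supported (Φ⁻ v) _)

    auxˡ-below : ∀ vs {k j} → j < k → auxˡ vs k j ≡ false
    auxˡ-below []           _   = refl
    auxˡ-below (v ∷ vs) {k} j<k = cong₂ _∨_ (supported-below (auxᵛ-supported v k) j<k)
                                            (auxˡ-below vs (<-≤-trans j<k (k≤nextᵛ v k)))

    canonical : Interp n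
    canonical (p v)   = lookup s v
    canonical (nv v)  = not (lookup s v)
    canonical (aux j) = auxˡ (allFin n) 0 j

    canonical-encodes : Encodes canonical s
    canonical-encodes v = refl , refl

    module _ {M : Interp n} (encodes : Encodes M s) where

      varRules-fixed : ∀ v k → ModelOfNegationFree M (varRules v k) → eval (f v) s ≡ lookup s v
      varRules-fixed v k (_ ∷ _ ∷ rule⁺ ∷ rule⁻ ∷ rules) with eval (f v) s in fv
      ... | true  = sym (trans (sym (proj₁ (encodes v))) (SatRule-definite⁻ (rule⁺ refl)
                      (bodyγ-holds encodes (Φ⁺ v) k (All.++⁻ˡ (rulesγ (Φ⁺ v) k) rules)
                        (trans (proj₁ (nnf v s)) fv))))
      ... | false = sym (not-injective (trans (sym (proj₂ (encodes v))) (SatRule-definite⁻ (rule⁻ refl)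
                      (bodyγ-holds encodes (Φ⁻ v) _ (All.++⁻ʳ (rulesγ (Φ⁺ v) k) rules)
                        (trans (proj₂ (nnf v s)) (cong not fv))))))

      fASP-fixedPoint : ModelOfNegationFree M (fASP f Φ) → FixedPoint f s
      fASP-fixedPoint model v with fASP-varRules model v
      ... | k , rules = varRules-fixed v k rules

      auxˡ-derived : ∀ vs k j → ModelOfNegationFree M (fASPlist Φ vs k) → auxˡ vs k j ≡ true → M (aux j) ≡ true
      auxˡ-derived (v ∷ vs) k j model e with All.++⁻ˡ (varRules v k) model | ∨-true⁻ (auxᵛ v k j) _ e
      ... | _ | inj₂ e-rest = auxˡ-derived vs _ j (All.++⁻ʳ (varRules v k) model) e-rest
      ... | _ ∷ _ ∷ _ ∷ _ ∷ rules | inj₁ eᵛ with ∨-true⁻ (auxγ (Φ⁺ v) k j) _ eᵛ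
      ...   | inj₁ e⁺ = auxγ-derived encodes (Φ⁺ v) k j (All.++⁻ˡ (rulesγ (Φ⁺ v) k) rules) e⁺
      ...   | inj₂ e⁻ = auxγ-derived encodes (Φ⁻ v) _ j (All.++⁻ʳ (rulesγ (Φ⁺ v) k) rules) e⁻

      canonical-least : ModelOfNegationFree M (fASP f Φ) → canonical ⊆ᴵ M
      canonical-least model (p v)   e = trans (proj₁ (encodes v)) e
      canonical-least model (nv v)  e = trans (proj₂ (encodes v)) e
      canonical-least model (aux j) e = auxˡ-derived (allFin n) 0 j model e

    module _ (fixed : FixedPoint f s) {C : Interp n} (encodes : Encodes C s) where

      varRules-model : ∀ v k → AgreesOn (C ∘ aux) (auxᵛ v k) k (nextᵛ v k) → Model C (varRules v k)
      varRules-model v k agree =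
        SatRule-choice⁺ (one-true (lookup s v) p≡ nv≡) ∷ SatRule-exclusion⁺ (one-false (lookup s v) p≡ nv≡) ∷
        allHead model⁺ ∷ allHead model⁻ ∷ All.++⁺ (allTail model⁺) (allTail model⁻)
        where
          p≡ : C (p v) ≡ lookup s v
          p≡ = proj₁ (encodes v)
          nv≡ : C (nv v) ≡ not (lookup s v)
          nv≡ = proj₂ (encodes v)
          k₁ : ℕ
          k₁ = nextγ (Φ⁺ v) k
          agree± : AgreesOn (C ∘ aux) (auxγ (Φ⁺ v) k) k k₁ × AgreesOn (C ∘ aux) (auxγ (Φ⁻ v) k₁) k₁ (nextᵛ v k)
          agree± = agrees-∨-adjacent (k≤nextγ (Φ⁺ v) k) (k≤nextγ (Φ⁻ v) _)
                     (auxγ-supported (Φ⁺ v) k) (auxγ-supported (Φ⁻ v) _) agree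
          model⁺ : Model C (rule (p v ∷ []) (bodyγ (Φ⁺ v) k) [] ∷ rulesγ (Φ⁺ v) k)
          model⁺ = definite-model encodes (p v) (Φ⁺ v) k (proj₁ agree±) λ e →
            trans p≡ (trans (sym (fixed v)) (trans (sym (proj₁ (nnf v s))) e))
          model⁻ : Model C (rule (nv v ∷ []) (bodyγ (Φ⁻ v) k₁) [] ∷ rulesγ (Φ⁻ v) k₁)
          model⁻ = definite-model encodes (nv v) (Φ⁻ v) k₁ (proj₂ agree±) λ e →
            trans nv≡ (trans (cong not (sym (fixed v))) (trans (sym (proj₂ (nnf v s))) e))

      fASPlist-model : ∀ vs k → AgreesFrom (C ∘ aux) (auxˡ vs k) k → Model C (fASPlist Φ vs k)
      fASPlist-model []       k _ = []
      fASPlist-model (v ∷ vs) k agree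
        with agreesFrom-∨-adjacent (k≤nextᵛ v k) (auxᵛ-supported v k) (auxˡ-below vs) agree
      ... | agreeᵛ , agreeˡ = All.++⁺ (varRules-model v k agreeᵛ) (fASPlist-model vs _ agreeˡ)

    canonical-fASP-model : FixedPoint f s → Model canonical (fASP f Φ)
    canonical-fASP-model fixed = fASPlist-model fixed canonical-encodes (allFin n) 0 (λ _ _ → refl)

    ⊆canonical-encodes : ∀ {N} → ModelOfNegationFree N (fASP f Φ) → N ⊆ᴵ canonical → Encodes N s
    ⊆canonical-encodes {N} model sub v with fASP-varRules model v
    ... | _ , (choice ∷ _) = choice-within (lookup s v) (SatRule-choice⁻ (choice refl)) (sub (p v)) (sub (nv v))

  module _ (β : Phenotype n) where

    P : Program n
    P = fASP f Φ ++ toASP β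

    model-sound : ∀ {M} → Model M P →
      FixedPoint f (stateOf M) × Satisfies (stateOf M) β × (∀ v → M (p v) ≡ not (M (nv v)))
    model-sound {M} model =
      fASP-fixedPoint (stateOf M) encodes negationFree ,
      toASP-satisfied (stateOf M) encodes β (All.++⁻ʳ (fASP f Φ) model) ,
      λ v → trans (sym (not-involutive _)) (cong not (sym (fASP-complementary negationFree v)))
      where
        negationFree : ModelOfNegationFree M (fASP f Φ)
        negationFree = model⇒negationFree (All.++⁻ˡ (fASP f Φ) model)
        encodes : Encodes M (stateOf M)
        encodes = fASP-encodes negationFree

    canonical-model : ∀ s → FixedPoint f s → Satisfies s β → Model (canonical s) P
    canonical-model s fixed sat = All.++⁺ (canonical-fASP-model s fixed) (toASP-model s (canonical-encodes s) β sat)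

    canonical-answerSet : ∀ s → FixedPoint f s → Satisfies s β → AnswerSet (canonical s) P
    canonical-answerSet s fixed sat = canonical-model s fixed sat , least
      where
        least : ∀ N → N ⊆ᴵ canonical s → Model N (reduct P (canonical s)) → canonical s ⊆ᴵ N
        least N sub reduct-model = canonical-least s (⊆canonical-encodes s negationFree sub) negationFree
          where
            negationFree : ModelOfNegationFree N (fASP f Φ)
            negationFree = All.++⁻ˡ (fASP f Φ) (reduct⇒negationFree P reduct-model)

    answerSet-canonical : ∀ {M} → AnswerSet M P → ∀ a → M a ≡ canonical (stateOf M) a
    answerSet-canonical {M} answerSet a = ⇔⇒≡ (M⊆C a) (C⊆M a)
      where
        negationFree : ModelOfNegationFree M (fASP f Φ)
        negationFree = model⇒negationFree (All.++⁻ˡ (fASP f Φ) (proj₁ answerSet))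
        sound : FixedPoint f (stateOf M) × Satisfies (stateOf M) β × (∀ v → M (p v) ≡ not (M (nv v)))
        sound = model-sound (proj₁ answerSet)
        C⊆M : canonical (stateOf M) ⊆ᴵ M
        C⊆M = canonical-least (stateOf M) (fASP-encodes negationFree) negationFree
        M⊆C : M ⊆ᴵ canonical (stateOf M)
        M⊆C = answerSet-minimal answerSet C⊆M (canonical-model _ (proj₁ sound) (proj₁ (proj₂ sound)))

theorem2 : ∀ {n : ℕ} (f : BN n) (Φ : Fin n → NNF n × NNF n) → IsNNFs f Φ →
    (β : Phenotype n) →
    ((M : Interp n) → AnswerSet M (fASP f Φ ++ toASP β) →
      FixedPoint f (stateOf M) × Satisfies (stateOf M) β ×
      ((v : Fin n) → M (p v) ≡ not (M (nv v))))
    × ((s : State n) → FixedPoint f s → Satisfies s β →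
      Σ (Interp n) (λ M → AnswerSet M (fASP f Φ ++ toASP β) × stateOf M ≡ s))
    × ((M M' : Interp n) → AnswerSet M (fASP f Φ ++ toASP β) →
      AnswerSet M' (fASP f Φ ++ toASP β) → stateOf M ≡ stateOf M' →
      (a : Atom n) → M a ≡ M' a)
theorem2 f Φ nnf β =
  (λ M answerSet → model-sound β (proj₁ answerSet)) ,
  (λ s fixed sat → canonical s , canonical-answerSet β s fixed sat , tabulate∘lookup s) ,
  λ M M′ answerSet answerSet′ same-state a →
    trans (answerSet-canonical β answerSet a)
          (trans (cong (λ s → canonical s a) same-state) (sym (answerSet-canonical β answerSet′ a)))
  where open Network f Φ nnf
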